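{- Let $\Delta$ be a bi-transitive bipartite digraph which contains no two (distinct) equivalent vertices. Then no directed circuit of $\Delta$ has length greater than $2$. In particular, every underlying oriented digraph of $\Delta$ is acyclic.
   Context: Digraphs have no loops or multiple edges; $N(u)$, $N^-(u)$ denote out- and in-neighbourhoods. A bipartite digraph has its vertices partitioned into two colour classes with every edge joining different classes; it is bi-transitive if whenever $u_1v_1,v_1u_2,u_2v_2$ are edges, $u_1v_2$ is an edge. Two vertices $x,y$ are equivalent if $N(x)=N(y)$ and $N^-(x)=N^-(y)$. A directed walk is a sequence $u_0\to u_1\to\cdots\to u_k$ with each $u_iu_{i+1}$ an edge; its length is $k$; a directed trail is a directed walk with all edges distinct; a directed circuit is a non-empty directed trail whose first and last vertices coincide; a directed cycle is a directed trail in which all vertices except the first and last are distinct. A symmetric edge is a pair $u,v$ with both $uv$ and $vu$ edges. An underlying oriented digraph of $\Delta$ is obtained by keeping the vertex set and, for every symmetric edge $\{uv,vu\}$, deleting exactly one of $uv,vu$ (all other edges kept). A digraph is acyclic if it has no directed cycle. -}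

module Defs where

open import Data.Nat using (ℕ; _≤_)
open import Data.Fin using (Fin; zero; suc; inject₁; fromℕ)
open import Data.Bool using (Bool)
open import Data.Product using (Σ; _×_)
open import Data.Sum using (_⊎_)
open import Function.Bundles using (_⇔_)
open import Relation.Nullary using (¬_)
open import Relation.Binary.PropositionalEquality using (_≡_; _≢_)

-- A digraph is given by a vertex type V and an edge relation E (E u v means uv is an edge).
-- Edges are identified with ordered pairs of vertices (no multiple edges).

module _ {V : Set} (E : V → V → Set) where

  Loopless : Set
  Loopless = ∀ v → ¬ E v v

  Bipartite : Set
  Bipartite = Σ (V → Bool) λ c → ∀ u v → E u v → c u ≢ c v

  BiTransitive : Set
  BiTransitive = ∀ u₁ v₁ u₂ v₂ → E u₁ v₁ → E v₁ u₂ → E u₂ v₂ → E u₁ v₂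

  Equivalent : V → V → Set
  Equivalent x y = (∀ z → E x z ⇔ E y z) × (∀ z → E z x ⇔ E z y)

  NoTwoEquivalent : Set
  NoTwoEquivalent = ∀ x y → Equivalent x y → x ≡ y

  IsWalk : (k : ℕ) → (Fin (Data.Nat.suc k) → V) → Set
  IsWalk k w = ∀ (i : Fin k) → E (w (inject₁ i)) (w (suc i))

  IsTrail : (k : ℕ) → (Fin (Data.Nat.suc k) → V) → Set
  IsTrail k w = IsWalk k w ×
    (∀ (i j : Fin k) → w (inject₁ i) ≡ w (inject₁ j) → w (suc i) ≡ w (suc j) → i ≡ j)

  IsCircuit : (k : ℕ) → (Fin (Data.Nat.suc k) → V) → Set
  IsCircuit k w = IsTrail k w × 1 ≤ k × w zero ≡ w (fromℕ k)

  IsCycle : (k : ℕ) → (Fin (Data.Nat.suc k) → V) → Set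
  IsCycle k w = IsTrail k w × 1 ≤ k × w zero ≡ w (fromℕ k) ×
    (∀ (i j : Fin k) → w (inject₁ i) ≡ w (inject₁ j) → i ≡ j)

  Acyclic : Set
  Acyclic = ∀ k w → ¬ IsCycle k w

IsUnderlyingOriented : {V : Set} → (E E' : V → V → Set) → Set
IsUnderlyingOriented E E' =
  (∀ u v → E' u v → E u v) ×
  (∀ u v → E u v → ¬ E v u → E' u v) ×
  (∀ u v → E u v → E v u → E' u v ⊎ E' v u) ×
  (∀ u v → E u v → E v u → ¬ (E' u v × E' v u))

-- Colour the vertices properly with two colours. Bi-transitivity shortcuts a walk
-- u₁ → v₁ → u₂ → v₂ to the edge u₁ → v₂, so every walk between vertices of different
-- colours shortcuts to a single edge. In a circuit a → b → c → d → ⋯ → a of length ≥ 3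
-- the walk from d back to a joins different colours, hence d → a is an edge, and on the
-- resulting 4-cycle bi-transitivity makes a, c equivalent and b, d equivalent. So a = c
-- and b = d, and the edges ab and cd of the circuit coincide, contradicting that it is
-- a trail. A directed cycle of an underlying oriented digraph is a circuit of Δ whose
-- length is neither 1 (no loops) nor 2 (only one edge of each symmetric pair survives).
module Submission where

open import Defs
open import Data.Nat using (zero; suc; _≤_; z≤n; s≤s)
open import Data.Nat.Properties using (<⇒≱)
open import Data.Fin using (Fin; fromℕ)
import Data.Fin as Fin
open import Data.Bool using (Bool)
open import Data.Empty using (⊥-elim)
open import Data.Bool.Properties using (¬-not)
open import Data.Product using (_×_; _,_)
open import Function.Base using (_∘_)
open import Function.Bundles using (mk⇔)
open import Relation.Nullary using (contradiction)
open import Relation.Binary.Construct.Closure.ReflexiveTransitive using (Star; ε; _◅_)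
open import Relation.Binary.PropositionalEquality using (_≡_; _≢_; refl; sym; trans; subst)

module _ {V : Set} {E : V → V → Set} where

  walk⇒star : ∀ k (w : Fin (suc k) → V) → IsWalk E k w → Star E (w Fin.zero) (w (fromℕ k))
  walk⇒star zero    w walk = ε
  walk⇒star (suc k) w walk = walk Fin.zero ◅ walk⇒star k (w ∘ Fin.suc) (walk ∘ Fin.suc)

  circuit-mono : ∀ {F : V → V → Set} → (∀ u v → E u v → F u v) →
                 ∀ k w → IsCircuit E k w → IsCircuit F k w
  circuit-mono E⊆F k w ((walk , distinct) , 1≤k , closed) =
    ((λ i → E⊆F _ _ (walk i)) , distinct) , 1≤k , closed

  cycle⇒circuit : ∀ k w → IsCycle E k w → IsCircuit E k w
  cycle⇒circuit k w (trail , 1≤k , closed , _) = trail , 1≤k , closed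

  BiTransitive⇒4-cycle-equivalent : BiTransitive E → ∀ {a b c d} →
    E a b → E b c → E c d → E d a → Equivalent E a c
  BiTransitive⇒4-cycle-equivalent bt ab bc cd da =
    (λ _ → mk⇔ (bt _ _ _ _ cd da) (bt _ _ _ _ ab bc)) ,
    (λ _ → mk⇔ (λ e → bt _ _ _ _ e ab bc) (λ e → bt _ _ _ _ e cd da))

  oriented-circuit-length≥3 : ∀ {E' : V → V → Set} → Loopless E → IsUnderlyingOriented E E' →
                              ∀ k w → IsCircuit E' k w → 3 ≤ k
  oriented-circuit-length≥3 _ _ zero w (_ , () , _)
  oriented-circuit-length≥3 {E'} loopless (E'⊆E , _) (suc zero) w ((walk , _) , _ , closed) =
    contradiction (subst (E' _) (sym closed) (walk Fin.zero)) (loopless _ ∘ E'⊆E _ _)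
  oriented-circuit-length≥3 {E'} _ (E'⊆E , _ , _ , one-of-pair) (suc (suc zero)) w ((walk , _) , _ , closed) =
    ⊥-elim (one-of-pair _ _ (E'⊆E _ _ uv) (E'⊆E _ _ vu) (uv , vu))
    where
      uv = walk Fin.zero
      vu = subst (E' _) (sym closed) (walk (Fin.suc Fin.zero))
  oriented-circuit-length≥3 _ _ (suc (suc (suc _))) _ _ = s≤s (s≤s (s≤s z≤n))

module _ {V : Set} {E : V → V → Set} {colour : V → Bool}
         (proper : ∀ u v → E u v → colour u ≢ colour v) (bt : BiTransitive E) where

  two-steps-same-colour : ∀ {a b c} → E a b → E b c → colour a ≡ colour c
  two-steps-same-colour ab bc =
    trans (¬-not (proper _ _ ab)) (sym (¬-not (proper _ _ bc ∘ sym)))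

  star⇒edge : ∀ {a b} → Star E a b → colour a ≢ colour b → E a b
  star⇒edge ε                     a≢a = contradiction refl a≢a
  star⇒edge (ab ◅ ε)              _   = ab
  star⇒edge (ab ◅ bc ◅ cd)        a≢d =
    bt _ _ _ _ ab bc (star⇒edge cd (a≢d ∘ trans (two-steps-same-colour ab bc)))

  circuit-length≤2 : NoTwoEquivalent E → ∀ k w → IsCircuit E k w → k ≤ 2
  circuit-length≤2 _   zero                w _ = z≤n
  circuit-length≤2 _   (suc zero)          w _ = s≤s z≤n
  circuit-length≤2 _   (suc (suc zero))    w _ = s≤s (s≤s z≤n)
  circuit-length≤2 nte (suc (suc (suc k))) w ((walk , distinct) , _ , closed) =
    contradiction (distinct Fin.zero (Fin.suc (Fin.suc Fin.zero)) a≡c b≡d) λ ()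
    where
      ab = walk Fin.zero
      bc = walk (Fin.suc Fin.zero)
      cd = walk (Fin.suc (Fin.suc Fin.zero))
      back : Star E (w (Fin.suc (Fin.suc (Fin.suc Fin.zero)))) (w Fin.zero)
      back = subst (Star E _) (sym closed)
               (walk⇒star k (w ∘ Fin.suc ∘ Fin.suc ∘ Fin.suc) (walk ∘ Fin.suc ∘ Fin.suc ∘ Fin.suc))
      da = star⇒edge back λ d≡a → proper _ _ cd (trans (sym (two-steps-same-colour ab bc)) (sym d≡a))
      a≡c = nte _ _ (BiTransitive⇒4-cycle-equivalent bt ab bc cd da)
      b≡d = nte _ _ (BiTransitive⇒4-cycle-equivalent bt bc cd da ab)

proposition1 : (V : Set) (E : V → V → Set) → Loopless E → Bipartite E → BiTransitive E →
    NoTwoEquivalent E →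
    (∀ k w → IsCircuit E k w → k ≤ 2) ×
    (∀ (E' : V → V → Set) → IsUnderlyingOriented E E' → Acyclic E')
proposition1 V E loopless (_ , proper) bt nte = short-circuits , acyclic
  where
    short-circuits : ∀ k w → IsCircuit E k w → k ≤ 2
    short-circuits = circuit-length≤2 proper bt nte

    acyclic : ∀ (E' : V → V → Set) → IsUnderlyingOriented E E' → Acyclic E'
    acyclic E' oriented@(E'⊆E , _) k w cycle =
      <⇒≱ (oriented-circuit-length≥3 {E = E} loopless oriented k w circuit)
          (short-circuits k w (circuit-mono E'⊆E k w circuit))
      where
        circuit : IsCircuit E' k w
        circuit = cycle⇒circuit {E = E'} k w cycle
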